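{- Let $\mathbb{A}$ be a $\mathsf{Cobounded}$-algebra. Then for all $u,v\in\mathbf{V}^{(\mathbb{A})}$, $f_{\mathbb{A}}(\llbracket u=v\rrbracket_{\mathrm{BA}})=\llbracket\bar u=\bar v\rrbracket_{\mathrm{BA}}$, where the right-hand side is computed in $\mathbf{V}^{(\mathbb{PS}_3)}$.
   Context: A $\mathsf{Cobounded}$-algebra is $\mathbb{A}=\langle\mathbf{A},\wedge,\vee,\Rightarrow,\mathbf{1},\mathbf{0}\rangle$ with complete distributive lattice reduct, such that $\bigvee_{i\in I}a_i=\mathbf{1}$ implies some $a_j=\mathbf{1}$, $\bigwedge_{i\in I}a_i=\mathbf{0}$ implies some $a_j=\mathbf{0}$, and $a\Rightarrow b=\mathbf{0}$ if $a\ne\mathbf{0}$ and $b=\mathbf{0}$, $=\mathbf{1}$ otherwise. $\mathbb{PS}_3$ is the three-element algebra on $\{1,\tfrac12,0\}$ ordered $0<\tfrac12<1$, with $\wedge=\min$, $\vee=\max$, and $a\Rightarrow b=0$ if $a\ne0$ and $b=0$, $a\Rightarrow b=1$ otherwise. $f_{\mathbb{A}}:\mathbf{A}\to\{1,\tfrac12,0\}$ sends $\mathbf{1}\mapsto1$, $\mathbf{0}\mapsto0$, and every other element to $\tfrac12$. For an algebra $\mathbb{C}$ with complete lattice reduct, $\mathbf{V}^{(\mathbb{C})}=\bigcup_\alpha\mathbf{V}^{(\mathbb{C})}_\alpha$, $\mathbf{V}^{(\mathbb{C})}_\alpha$ = functions with range in the universe of $\mathbb{C}$ and domain $\subseteq\mathbf{V}^{(\mathbb{C})}_\xi$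 for some $\xi<\alpha$. For $u\in\mathbf{V}^{(\mathbb{A})}$, $\bar u\in\mathbf{V}^{(\mathbb{PS}_3)}$ is defined recursively by $\bar u=\{\langle\bar x,f_{\mathbb{A}}(a)\rangle:\langle x,a\rangle\in u\}$. $\llbracket u\in v\rrbracket_{\mathrm{BA}}=\bigvee_{x\in\mathrm{dom}(v)}(v(x)\wedge\llbracket x=u\rrbracket_{\mathrm{BA}})$, $\llbracket u=v\rrbracket_{\mathrm{BA}}=\bigwedge_{x\in\mathrm{dom}(u)}(u(x)\Rightarrow\llbracket x\in v\rrbracket_{\mathrm{BA}})\wedge\bigwedge_{y\in\mathrm{dom}(v)}(v(y)\Rightarrow\llbracket y\in u\rrbracket_{\mathrm{BA}})$ (in the respective algebra). -}

module Defs where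

open import Level using (Level; _⊔_) renaming (suc to lsuc)
open import Data.Product using (∃; _,_)
open import Relation.Nullary using (¬_; Dec; yes; no)
open import Relation.Binary.PropositionalEquality using (_≡_; _≢_)
open import Algebra.Lattice.Structures using (IsDistributiveLattice)
open import Axiom.ExcludedMiddle using (ExcludedMiddle)

-- The operations needed to compute Boolean-style truth values of
-- set-theoretic formulas in an algebra with complete lattice reduct.
-- Arbitrary joins/meets are taken over index types in Set ℓ.
record Ops (c ℓ : Level) : Set (lsuc (c ⊔ ℓ)) where
  field
    Carrier : Set c
    _∧_ _⇒_ : Carrier → Carrier → Carrier
    ⋁ ⋀ : {I : Set ℓ} → (I → Carrier) → Carrier

record CoboundedAlgebra (c ℓ : Level) : Set (lsuc (c ⊔ ℓ)) where
  field
    ops : Ops c ℓ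
  open Ops ops public
  field
    _∨_ : Carrier → Carrier → Carrier
    𝟏 𝟎 : Carrier
    isDistributiveLattice : IsDistributiveLattice _≡_ _∨_ _∧_
  _≤_ : Carrier → Carrier → Set c
  a ≤ b = (a ∧ b) ≡ a
  field
    𝟎-least    : ∀ a → 𝟎 ≤ a
    𝟏-greatest : ∀ a → a ≤ 𝟏
    ⋁-upper : ∀ {I : Set ℓ} (f : I → Carrier) (i : I) → f i ≤ ⋁ f
    ⋁-least : ∀ {I : Set ℓ} (f : I → Carrier) (b : Carrier) → (∀ i → f i ≤ b) → ⋁ f ≤ b
    ⋀-lower : ∀ {I : Set ℓ} (f : I → Carrier) (i : I) → ⋀ f ≤ f i
    ⋀-great : ∀ {I : Set ℓ} (f : I → Carrier) (b : Carrier) → (∀ i → b ≤ f i) → b ≤ ⋀ f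
    ⋁-cobounded : ∀ {I : Set ℓ} (f : I → Carrier) → ⋁ f ≡ 𝟏 → ∃ λ j → f j ≡ 𝟏
    ⋀-cobounded : ∀ {I : Set ℓ} (f : I → Carrier) → ⋀ f ≡ 𝟎 → ∃ λ j → f j ≡ 𝟎
    ⇒-𝟎  : ∀ a b → a ≢ 𝟎 → b ≡ 𝟎 → (a ⇒ b) ≡ 𝟎
    ⇒-𝟏ˡ : ∀ a b → a ≡ 𝟎 → (a ⇒ b) ≡ 𝟏
    ⇒-𝟏ʳ : ∀ a b → b ≢ 𝟎 → (a ⇒ b) ≡ 𝟏

-- Algebra-valued universe V^(C): well-founded trees of names,
-- a name being a family of names (the domain) with C-values.
data V {c : Level} (ℓ : Level) (C : Set c) : Set (c ⊔ lsuc ℓ) where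
  sup : (I : Set ℓ) → (I → V ℓ C) → (I → C) → V ℓ C

dom : ∀ {c ℓ} {C : Set c} → V ℓ C → Set ℓ
dom (sup I _ _) = I

module Truth {c ℓ : Level} (O : Ops c ℓ) where
  open Ops O
  -- ⟦ u = v ⟧ with ⟦ x ∈ v ⟧ = ⋁_{y ∈ dom v} (v(y) ∧ ⟦ y = x ⟧) unfolded
  ⟦_≐_⟧ : V ℓ Carrier → V ℓ Carrier → Carrier
  ⟦ sup I f a ≐ sup J g b ⟧ =
      ⋀ (λ i → a i ⇒ ⋁ (λ j → b j ∧ ⟦ g j ≐ f i ⟧))
    ∧ ⋀ (λ j → b j ⇒ ⋁ (λ i → a i ∧ ⟦ f i ≐ g j ⟧))

  ⟦_∈_⟧ : V ℓ Carrier → V ℓ Carrier → Carrier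
  ⟦ u ∈ sup J g b ⟧ = ⋁ (λ j → b j ∧ ⟦ g j ≐ u ⟧)

data Three : Set where
  one half zero : Three

min max : Three → Three → Three
min zero _ = zero
min _ zero = zero
min half _ = half
min _ half = half
min one one = one
max one _ = one
max _ one = one
max half _ = half
max _ half = half
max zero zero = zero

_⇒₃_ : Three → Three → Three
zero ⇒₃ _ = one
one  ⇒₃ zero = zero
half ⇒₃ zero = zero
_ ⇒₃ one = one
_ ⇒₃ half = one

module _ {ℓ : Level} (lem : ExcludedMiddle ℓ) where
  sup₃ : {I : Set ℓ} → (I → Three) → Three
  sup₃ f with lem {∃ λ j → f j ≡ one}
  ... | yes _ = one
  ... | no _ with lem {∃ λ j → f j ≡ half}
  ...   | yes _ = half
  ...   | no _ = zero

  inf₃ : {I : Set ℓ} → (I → Three) → Three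
  inf₃ f with lem {∃ λ j → f j ≡ zero}
  ... | yes _ = zero
  ... | no _ with lem {∃ λ j → f j ≡ half}
  ...   | yes _ = half
  ...   | no _ = one

  PS3 : Ops Level.zero ℓ
  PS3 = record { Carrier = Three ; _∧_ = min ; _⇒_ = _⇒₃_ ; ⋁ = sup₃ ; ⋀ = inf₃ }

module _ {c ℓ : Level} (lem : ExcludedMiddle c) (A : CoboundedAlgebra c ℓ) where
  open CoboundedAlgebra A
  f : Carrier → Three
  f a with lem {a ≡ 𝟏}
  ... | yes _ = one
  ... | no _ with lem {a ≡ 𝟎}
  ...   | yes _ = zero
  ...   | no _ = half

  bar : V ℓ Carrier → V ℓ Three
  bar (sup I g a) = sup I (λ i → bar (g i)) (λ i → f (a i))

{-# OPTIONS --safe #-}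
-- In a cobounded algebra, whether an operation yields 𝟏 or 𝟎 depends only on
-- which of its arguments are 𝟏 or 𝟎, exactly as in PS3: a join is 𝟏 iff some
-- argument is and 𝟎 iff all are, dually for meets, and a ⇒ b is fixed by
-- a = 𝟎 and b = 𝟎. So f commutes with ∧, ⇒, ⋁ and ⋀, and since ⟦ u ≐ v ⟧ is
-- built from these, induction on names gives the theorem.
module Submission where

open import Defs
open import Level using (Level; Lift; lift)
open import Axiom.ExcludedMiddle using (ExcludedMiddle)
open import Algebra.Lattice.Bundles using (DistributiveLattice)
import Algebra.Lattice.Properties.DistributiveLattice as DistributiveLatticeProperties
open import Data.Bool using (Bool; true; false)
open import Data.Empty using (⊥; ⊥-elim)
open import Data.Product using (∃; _,_)
open import Data.Sum using (_⊎_; inj₁; inj₂; [_,_])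
open import Function using (_∘_)
open import Function.Bundles using (_⇔_; mk⇔; Equivalence)
open import Relation.Nullary using (yes; no)
open import Relation.Binary.PropositionalEquality
  using (_≡_; _≢_; refl; sym; trans; cong; subst; module ≡-Reasoning)

open Equivalence using (to; from)

module CoboundedAlgebraProperties {c ℓ : Level} (A : CoboundedAlgebra c ℓ) where
  open CoboundedAlgebra A

  distributiveLattice : DistributiveLattice c c
  distributiveLattice = record
    { Carrier = Carrier ; _≈_ = _≡_ ; _∨_ = _∨_ ; _∧_ = _∧_
    ; isDistributiveLattice = isDistributiveLattice }

  open DistributiveLattice distributiveLattice using (∧-comm; ∧-assoc)
  open DistributiveLatticeProperties distributiveLattice using (∧-idem)

  ∧-zeroʳ : ∀ a → a ∧ 𝟎 ≡ 𝟎
  ∧-zeroʳ a = trans (∧-comm a 𝟎) (𝟎-least a)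

  ∧-identityˡ : ∀ a → 𝟏 ∧ a ≡ a
  ∧-identityˡ a = trans (∧-comm 𝟏 a) (𝟏-greatest a)

  ∧-greatest : ∀ {x a b} → x ≤ a → x ≤ b → x ≤ (a ∧ b)
  ∧-greatest {x} {a} {b} x≤a x≤b = trans (sym (∧-assoc x a b)) (trans (cong (_∧ b) x≤a) x≤b)

  ≤𝟎⇒≡𝟎 : ∀ {a} → a ≤ 𝟎 → a ≡ 𝟎
  ≤𝟎⇒≡𝟎 {a} a≤𝟎 = trans (sym a≤𝟎) (∧-zeroʳ a)

  𝟏≤⇒≡𝟏 : ∀ {a} → 𝟏 ≤ a → a ≡ 𝟏
  𝟏≤⇒≡𝟏 {a} 𝟏≤a = trans (sym (∧-identityˡ a)) 𝟏≤a

  -- The empty join is 𝟎, and by coboundedness it is not 𝟏.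
  𝟎≢𝟏 : 𝟎 ≢ 𝟏
  𝟎≢𝟏 𝟎≡𝟏 with ⋁-cobounded empty (trans ⋁empty≡𝟎 𝟎≡𝟏)
    where
      empty : Lift ℓ ⊥ → Carrier
      empty ()
      ⋁empty≡𝟎 : ⋁ empty ≡ 𝟎
      ⋁empty≡𝟎 = ≤𝟎⇒≡𝟎 (⋁-least empty 𝟎 λ ())
  ... | () , _

  ≡𝟏⇒≢𝟎 : ∀ {a} → a ≡ 𝟏 → a ≢ 𝟎
  ≡𝟏⇒≢𝟎 a≡𝟏 a≡𝟎 = 𝟎≢𝟏 (trans (sym a≡𝟎) a≡𝟏)

  ∧≡𝟏⇒ˡ : ∀ {a b} → a ∧ b ≡ 𝟏 → a ≡ 𝟏
  ∧≡𝟏⇒ˡ {a} {b} a∧b≡𝟏 = begin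
    a            ≡⟨ sym (𝟏-greatest a) ⟩
    a ∧ 𝟏        ≡⟨ cong (a ∧_) (sym a∧b≡𝟏) ⟩
    a ∧ (a ∧ b)  ≡⟨ sym (∧-assoc a a b) ⟩
    (a ∧ a) ∧ b  ≡⟨ cong (_∧ b) (∧-idem a) ⟩
    a ∧ b        ≡⟨ a∧b≡𝟏 ⟩
    𝟏            ∎
    where open ≡-Reasoning

  ∧≡𝟎⇒ : ∀ {a b} → a ∧ b ≡ 𝟎 → a ≡ 𝟎 ⊎ b ≡ 𝟎
  ∧≡𝟎⇒ {a} {b} a∧b≡𝟎 with ⋀-cobounded pair ⋀pair≡𝟎
    where
      pair : Lift ℓ Bool → Carrier
      pair (lift true)  = a
      pair (lift false) = b
      ⋀pair≡𝟎 : ⋀ pair ≡ 𝟎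
      ⋀pair≡𝟎 = ≤𝟎⇒≡𝟎 (subst (⋀ pair ≤_) a∧b≡𝟎
        (∧-greatest (⋀-lower pair (lift true)) (⋀-lower pair (lift false))))
  ... | lift true  , a≡𝟎 = inj₁ a≡𝟎
  ... | lift false , b≡𝟎 = inj₂ b≡𝟎

  module _ {I : Set ℓ} {h : I → Carrier} where

    ⋁≡𝟏⇔ : ⋁ h ≡ 𝟏 ⇔ ∃ λ j → h j ≡ 𝟏
    ⋁≡𝟏⇔ = mk⇔ (⋁-cobounded h) λ (j , hj≡𝟏) → 𝟏≤⇒≡𝟏 (subst (_≤ ⋁ h) hj≡𝟏 (⋁-upper h j))

    ⋁≡𝟎⇔ : ⋁ h ≡ 𝟎 ⇔ (∀ j → h j ≡ 𝟎)
    ⋁≡𝟎⇔ = mk⇔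
      (λ ⋁h≡𝟎 j → ≤𝟎⇒≡𝟎 (subst (h j ≤_) ⋁h≡𝟎 (⋁-upper h j)))
      (λ h≡𝟎 → ≤𝟎⇒≡𝟎 (⋁-least h 𝟎 λ j → subst (_≤ 𝟎) (sym (h≡𝟎 j)) (𝟎-least 𝟎)))

    ⋀≡𝟎⇔ : ⋀ h ≡ 𝟎 ⇔ ∃ λ j → h j ≡ 𝟎
    ⋀≡𝟎⇔ = mk⇔ (⋀-cobounded h) λ (j , hj≡𝟎) → ≤𝟎⇒≡𝟎 (subst (⋀ h ≤_) hj≡𝟎 (⋀-lower h j))

    ⋀≡𝟏⇔ : ⋀ h ≡ 𝟏 ⇔ (∀ j → h j ≡ 𝟏)
    ⋀≡𝟏⇔ = mk⇔
      (λ ⋀h≡𝟏 j → 𝟏≤⇒≡𝟏 (subst (_≤ h j) ⋀h≡𝟏 (⋀-lower h j)))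
      (λ h≡𝟏 → 𝟏≤⇒≡𝟏 (⋀-great h 𝟏 λ j → subst (𝟏 ≤_) (sym (h≡𝟏 j)) (𝟏-greatest 𝟏)))

≢one⇒≢half⇒≡zero : ∀ {t} → t ≢ one → t ≢ half → t ≡ zero
≢one⇒≢half⇒≡zero {one}  t≢one _ = ⊥-elim (t≢one refl)
≢one⇒≢half⇒≡zero {half} _ t≢half = ⊥-elim (t≢half refl)
≢one⇒≢half⇒≡zero {zero} _ _ = refl

≢zero⇒≢half⇒≡one : ∀ {t} → t ≢ zero → t ≢ half → t ≡ one
≢zero⇒≢half⇒≡one {one}  _ _ = refl
≢zero⇒≢half⇒≡one {half} _ t≢half = ⊥-elim (t≢half refl)
≢zero⇒≢half⇒≡one {zero} t≢zero _ = ⊥-elim (t≢zero refl)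

module Collapse {c ℓ : Level} (lemC : ExcludedMiddle c) (A : CoboundedAlgebra c ℓ) where
  open CoboundedAlgebra A
  open CoboundedAlgebraProperties A

  -- The graph of f lemC A.
  data Class (a : Carrier) : Three → Set c where
    top    : a ≡ 𝟏 → Class a one
    bottom : a ≡ 𝟎 → Class a zero
    middle : a ≢ 𝟏 → a ≢ 𝟎 → Class a half

  classify : ∀ a → Class a (f lemC A a)
  classify a with lemC {a ≡ 𝟏}
  ... | yes a≡𝟏 = top a≡𝟏
  ... | no a≢𝟏 with lemC {a ≡ 𝟎}
  ...   | yes a≡𝟎 = bottom a≡𝟎
  ...   | no a≢𝟎  = middle a≢𝟏 a≢𝟎

  module _ {a : Carrier} {t : Three} where

    one⇒𝟏 : Class a t → t ≡ one → a ≡ 𝟏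
    one⇒𝟏 (top a≡𝟏) _ = a≡𝟏

    zero⇒𝟎 : Class a t → t ≡ zero → a ≡ 𝟎
    zero⇒𝟎 (bottom a≡𝟎) _ = a≡𝟎

    half⇒≢𝟏 : Class a t → t ≡ half → a ≢ 𝟏
    half⇒≢𝟏 (middle a≢𝟏 _) _ = a≢𝟏

    half⇒≢𝟎 : Class a t → t ≡ half → a ≢ 𝟎
    half⇒≢𝟎 (middle _ a≢𝟎) _ = a≢𝟎

    𝟏⇒one : Class a t → a ≡ 𝟏 → t ≡ one
    𝟏⇒one (top _)        _   = refl
    𝟏⇒one (bottom a≡𝟎)   a≡𝟏 = ⊥-elim (≡𝟏⇒≢𝟎 a≡𝟏 a≡𝟎)
    𝟏⇒one (middle a≢𝟏 _) a≡𝟏 = ⊥-elim (a≢𝟏 a≡𝟏)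

    𝟎⇒zero : Class a t → a ≡ 𝟎 → t ≡ zero
    𝟎⇒zero (top a≡𝟏)      a≡𝟎 = ⊥-elim (≡𝟏⇒≢𝟎 a≡𝟏 a≡𝟎)
    𝟎⇒zero (bottom _)     _   = refl
    𝟎⇒zero (middle _ a≢𝟎) a≡𝟎 = ⊥-elim (a≢𝟎 a≡𝟎)

  Class-functional : ∀ {a s t} → Class a s → Class a t → s ≡ t
  Class-functional a∈s (top a≡𝟏)    = 𝟏⇒one a∈s a≡𝟏
  Class-functional a∈s (bottom a≡𝟎) = 𝟎⇒zero a∈s a≡𝟎
  Class-functional (top a≡𝟏)    (middle a≢𝟏 _) = ⊥-elim (a≢𝟏 a≡𝟏)
  Class-functional (bottom a≡𝟎) (middle _ a≢𝟎) = ⊥-elim (a≢𝟎 a≡𝟎)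
  Class-functional (middle _ _) (middle _ _)   = refl

  ∧-class : ∀ {a b s t} → Class a s → Class b t → Class (a ∧ b) (min s t)
  ∧-class (bottom refl) _ = bottom (𝟎-least _)
  ∧-class (top refl) (top refl) = top (𝟏-greatest 𝟏)
  ∧-class (top refl) (bottom refl) = bottom (∧-zeroʳ 𝟏)
  ∧-class (top refl) b∈half@(middle _ _) = subst (λ x → Class x half) (sym (∧-identityˡ _)) b∈half
  ∧-class (middle _ _) (bottom refl) = bottom (∧-zeroʳ _)
  ∧-class a∈half@(middle _ _) (top refl) = subst (λ x → Class x half) (sym (𝟏-greatest _)) a∈half
  ∧-class (middle a≢𝟏 a≢𝟎) (middle _ b≢𝟎) = middle (a≢𝟏 ∘ ∧≡𝟏⇒ˡ) ([ a≢𝟎 , b≢𝟎 ] ∘ ∧≡𝟎⇒)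

  ⇒-class : ∀ {a b s t} → Class a s → Class b t → Class (a ⇒ b) (s ⇒₃ t)
  ⇒-class (bottom a≡𝟎) _ = top (⇒-𝟏ˡ _ _ a≡𝟎)
  ⇒-class (top a≡𝟏) (bottom b≡𝟎) = bottom (⇒-𝟎 _ _ (≡𝟏⇒≢𝟎 a≡𝟏) b≡𝟎)
  ⇒-class (middle _ a≢𝟎) (bottom b≡𝟎) = bottom (⇒-𝟎 _ _ a≢𝟎 b≡𝟎)
  ⇒-class (top _) (top b≡𝟏) = top (⇒-𝟏ʳ _ _ (≡𝟏⇒≢𝟎 b≡𝟏))
  ⇒-class (middle _ _) (top b≡𝟏) = top (⇒-𝟏ʳ _ _ (≡𝟏⇒≢𝟎 b≡𝟏))
  ⇒-class (top _) (middle _ b≢𝟎) = top (⇒-𝟏ʳ _ _ b≢𝟎)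
  ⇒-class (middle _ _) (middle _ b≢𝟎) = top (⇒-𝟏ʳ _ _ b≢𝟎)

  module _ (lemI : ExcludedMiddle ℓ) where

    module _ {I : Set ℓ} {h : I → Carrier} {k : I → Three}
             (h∈k : ∀ i → Class (h i) (k i)) where

      ⋁-class : Class (⋁ h) (sup₃ lemI k)
      ⋁-class with lemI {∃ λ j → k j ≡ one}
      ... | yes (j , kj≡one) = top (from ⋁≡𝟏⇔ (j , one⇒𝟏 (h∈k j) kj≡one))
      ... | no ∄one with lemI {∃ λ j → k j ≡ half}
      ...   | yes (j , kj≡half) = middle
                (λ ⋁h≡𝟏 → let i , hi≡𝟏 = to ⋁≡𝟏⇔ ⋁h≡𝟏 in ∄one (i , 𝟏⇒one (h∈k i) hi≡𝟏))
                (λ ⋁h≡𝟎 → half⇒≢𝟎 (h∈k j) kj≡half (to ⋁≡𝟎⇔ ⋁h≡𝟎 j))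
      ...   | no ∄half = bottom (from ⋁≡𝟎⇔ λ i →
                zero⇒𝟎 (h∈k i) (≢one⇒≢half⇒≡zero (λ e → ∄one (i , e)) (λ e → ∄half (i , e))))

      ⋀-class : Class (⋀ h) (inf₃ lemI k)
      ⋀-class with lemI {∃ λ j → k j ≡ zero}
      ... | yes (j , kj≡zero) = bottom (from ⋀≡𝟎⇔ (j , zero⇒𝟎 (h∈k j) kj≡zero))
      ... | no ∄zero with lemI {∃ λ j → k j ≡ half}
      ...   | yes (j , kj≡half) = middle
                (λ ⋀h≡𝟏 → half⇒≢𝟏 (h∈k j) kj≡half (to ⋀≡𝟏⇔ ⋀h≡𝟏 j))
                (λ ⋀h≡𝟎 → let i , hi≡𝟎 = to ⋀≡𝟎⇔ ⋀h≡𝟎 in ∄zero (i , 𝟎⇒zero (h∈k i) hi≡𝟎))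
      ...   | no ∄half = top (from ⋀≡𝟏⇔ λ i →
                one⇒𝟏 (h∈k i) (≢zero⇒≢half⇒≡one (λ e → ∄zero (i , e)) (λ e → ∄half (i , e))))

    open Truth ops using () renaming (⟦_≐_⟧ to ⟦_≐_⟧ᴬ)
    open Truth (PS3 lemI) using () renaming (⟦_≐_⟧ to ⟦_≐_⟧₃)

    ≐-class : ∀ u v → Class ⟦ u ≐ v ⟧ᴬ ⟦ bar lemC A u ≐ bar lemC A v ⟧₃
    ≐-class (sup _ g a) (sup _ h b) = ∧-class
      (⋀-class λ i → ⇒-class (classify (a i)) (⋁-class λ j →
        ∧-class (classify (b j)) (≐-class (h j) (g i))))
      (⋀-class λ j → ⇒-class (classify (b j)) (⋁-class λ i →
        ∧-class (classify (a i)) (≐-class (g i) (h j))))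

mainTheorem14 : {c ℓ : Level} (lemC : ExcludedMiddle c) (lemI : ExcludedMiddle ℓ)
    (A : CoboundedAlgebra c ℓ) (u v : V ℓ (CoboundedAlgebra.Carrier A)) →
    f lemC A (Truth.⟦_≐_⟧ (CoboundedAlgebra.ops A) u v)
      ≡ Truth.⟦_≐_⟧ (PS3 lemI) (bar lemC A u) (bar lemC A v)
mainTheorem14 lemC lemI A u v = Class-functional (classify _) (≐-class lemI u v)
  where open Collapse lemC A
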